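{- Let $G_1,\ldots,G_l$ be $n$-symmetric graphs each having $n$ vertices. Then for any $n$-symmetric join $G$ of $G_1,\ldots,G_l$, we have $m_G(l)\ge l-1$.
   Context: A finite simple graph $G$ is $k$-symmetric if $\mathrm{Aut}(G)$ contains a subgroup isomorphic to $\mathbb{Z}_k$ acting freely on $V(G)$; a generator $\varphi$ of such a subgroup is a $k$-symmetric automorphism. A base of $\varphi$ is a minimal subset $B\subseteq V(G)$ with $\bigcup_{i=0}^{k-1}\varphi^i(B)=V(G)$ (one vertex from each orbit). The $k$-symmetric join $G_1\vee_k\cdots\vee_k G_l$, given $k$-symmetric automorphisms $\varphi_i$ of $G_i$ with chosen bases $B_i$, is the graph obtained from the disjoint union $G_1\cup\cdots\cup G_l$ by adding, for every $j\in\mathbb{Z}_k$ and every pair $i\ne i'$, all edges between vertices of $\varphi_i^j(B_i)$ and vertices of $\varphi_{i'}^j(B_{i'})$. An $n$-symmetric join of $G_1,\dots,G_l$ means such a graph for an arbitrary choice of the $\varphi_i$ and $B_i$ with $k=n$. $m_G(\lambda)$ is the multiplicity of $\lambda$ as an eigenvalue of the Laplacian $L(G)=D(G)-A(G)$. -}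

module Defs where

open import Data.Nat using (ℕ; zero; suc; _*_)
open import Data.Bool using (Bool; true; false; _∧_; _∨_; if_then_else_)
open import Data.Fin using (Fin; toℕ; remQuot; _≟_)
open import Data.Fin.Permutation using (Permutation′; _⟨$⟩ʳ_)
open import Data.Product using (Σ; ∃; ∃-syntax; _×_; _,_)
open import Data.Integer using (+_)
open import Data.Rational using (ℚ; 0ℚ; _+_; _-_; _/_)
import Data.Rational as Q
open import Relation.Nullary using (¬_)
open import Relation.Nullary.Decidable using (⌊_⌋)
open import Relation.Binary.PropositionalEquality using (_≡_)

ΣFin : (n : ℕ) → (Fin n → ℚ) → ℚ
ΣFin zero    f = 0ℚ
ΣFin (suc n) f = f Fin.zero + ΣFin n (λ i → f (Fin.suc i))
  where import Data.Fin as Fin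

anyFin : (n : ℕ) → (Fin n → Bool) → Bool
anyFin zero    f = false
anyFin (suc n) f = f Fin.zero ∨ anyFin n (λ i → f (Fin.suc i))
  where import Data.Fin as Fin

record Graph (n : ℕ) : Set where
  field
    adj   : Fin n → Fin n → Bool
    sym   : ∀ u v → adj u v ≡ adj v u
    irrefl : ∀ v → adj v v ≡ false
open Graph public

pow : {n : ℕ} → Permutation′ n → ℕ → Fin n → Fin n
pow φ zero    v = v
pow φ (suc j) v = φ ⟨$⟩ʳ (pow φ j v)

IsAutomorphism : {n : ℕ} → Graph n → Permutation′ n → Set
IsAutomorphism G φ = ∀ u v → adj G (φ ⟨$⟩ʳ u) (φ ⟨$⟩ʳ v) ≡ adj G u v

-- φ is a k-symmetric automorphism: an automorphism generating a subgroup
-- ≅ ℤ_k of Aut(G) acting freely, i.e. φ^k = id and φ^j has no fixed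
-- point for 0 < j < k.
IsKSymmetricAut : {n : ℕ} → ℕ → Graph n → Permutation′ n → Set
IsKSymmetricAut {n} k G φ =
  IsAutomorphism G φ
  × (∀ v → pow φ k v ≡ v)
  × (∀ (j : ℕ) → 0 Data.Nat.< j → j Data.Nat.< k → ∀ v → ¬ (pow φ j v ≡ v))
  where import Data.Nat

Subset : ℕ → Set
Subset n = Fin n → Bool

_⊆_ : {n : ℕ} → Subset n → Subset n → Set
A ⊆ B = ∀ v → A v ≡ true → B v ≡ true

Covers : {n : ℕ} → ℕ → Permutation′ n → Subset n → Set
Covers {n} k φ B = ∀ v → ∃[ j ] (j Data.Nat.< k × ∃[ b ] (B b ≡ true × pow φ j b ≡ v))
  where import Data.Nat

IsBase : {n : ℕ} → ℕ → Permutation′ n → Subset n → Set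
IsBase k φ B = Covers k φ B × (∀ B' → B' ⊆ B → Covers k φ B' → B ⊆ B')

inLayer : {n : ℕ} → Permutation′ n → Subset n → ℕ → Fin n → Bool
inLayer {n} φ B j u = anyFin n (λ b → B b ∧ ⌊ pow φ j b ≟ u ⌋)

-- Adjacency of the k-symmetric join G_1 ∨_k ... ∨_k G_l of l graphs on Fin n,
-- with vertex set the disjoint union Fin l × Fin n, encoded as Fin (l * n)
-- via remQuot (vertex (i , u) = vertex u of the i-th graph).
joinAdj : (k l n : ℕ) → (Fin l → Graph n) → (Fin l → Permutation′ n) → (Fin l → Subset n)
        → Fin (l * n) → Fin (l * n) → Bool
joinAdj k l n G φ B x y with remQuot {l} n x | remQuot {l} n y
... | (i , u) | (i' , u') =
  if ⌊ i ≟ i' ⌋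
  then adj (G i) u u'
  else anyFin k (λ j → inLayer (φ i) (B i) (toℕ j) u ∧ inLayer (φ i') (B i') (toℕ j) u')

boolℚ : Bool → ℚ
boolℚ true  = + 1 / 1
boolℚ false = 0ℚ

laplacianApply : {N : ℕ} → (Fin N → Fin N → Bool) → (Fin N → ℚ) → Fin N → ℚ
laplacianApply {N} a x v =
  (ΣFin N (λ w → boolℚ (a v w))) Q.* x v - ΣFin N (λ w → boolℚ (a v w) Q.* x w)

InEigenspace : {N : ℕ} → (Fin N → Fin N → Bool) → ℚ → (Fin N → ℚ) → Set
InEigenspace a λ' x = ∀ v → laplacianApply a x v ≡ λ' Q.* x v

LinearlyIndependent : {N m : ℕ} → (Fin m → Fin N → ℚ) → Set
LinearlyIndependent {N} {m} xs =
  ∀ (c : Fin m → ℚ) → (∀ v → ΣFin m (λ t → c t Q.* xs t v) ≡ 0ℚ) → ∀ t → c t ≡ 0ℚ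

-- m_G(λ) ≥ m : the λ-eigenspace of the (symmetric, rational) Laplacian has
-- dimension at least m (for a symmetric matrix the multiplicity of an eigenvalue
-- equals the dimension of its eigenspace).
MultiplicityAtLeast : {N : ℕ} → (Fin N → Fin N → Bool) → ℚ → ℕ → Set
MultiplicityAtLeast {N} a λ' m =
  Σ (Fin m → Fin N → ℚ) (λ xs → LinearlyIndependent xs × (∀ t → InEigenspace a λ' (xs t)))

-- Each base of a free ℤ_n-action on n vertices is a single vertex b, and every vertex is
-- φ^j b for exactly one j < n.  Hence in the n-symmetric join every vertex of G_i has
-- exactly one neighbour in each other block G_i'.  For a vector that is constant c_i on
-- block i, L x at a vertex of block i is therefore Σ_i' (c_i − c_i') = l c_i − Σ c, so
-- every block-constant vector with Σ c = 0 is an l-eigenvector; these form a space of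
-- dimension l − 1.
module Submission where

open import Defs hiding (sym)
open import Data.Nat using (ℕ; zero; suc; NonZero; _∸_)
open import Data.Fin using (Fin)
open import Data.Fin.Permutation using (Permutation′)
open import Data.Integer using (+_)
open import Data.Rational using (_/_)

open import Data.Bool using (Bool; true; false; _∧_; if_then_else_)
open import Data.Bool.Properties using (∨-zeroʳ; ∧-conicalˡ; ∧-conicalʳ; ¬-not)
open import Data.Empty using (⊥-elim)
import Data.Empty.Irrelevant as Irrelevant
open import Data.Fin using (zero; suc; toℕ; combine; quotient; _≟_; _↑ˡ_; _↑ʳ_; punchOut)
import Data.Fin.Properties as Finₚ
open import Data.Fin.Permutation using (_⟨$⟩ʳ_)
import Data.Integer.Properties as ℤₚ
import Data.Nat as ℕ
import Data.Nat.Properties as ℕₚ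
open import Data.Nat.Coprimality using (1-coprimeTo) renaming (sym to coprime-sym)
open import Data.Product using (∃; _,_; proj₁; proj₂; swap)
open import Data.Rational using (ℚ; 0ℚ; 1ℚ; _+_; _*_; _-_; -_)
open import Data.Rational.Properties hiding (_≟_)
open import Data.Rational.Solver using (module +-*-Solver)
open import Function.Base using (_∘_)
open import Function.Definitions using (Injective)
open import Relation.Nullary using (¬_; Dec; yes; no)
open import Relation.Nullary.Decidable using (⌊_⌋; isYes≗does; dec-true; dec-false)
open import Relation.Binary.Definitions using (tri<; tri≈; tri>)
open import Relation.Binary.PropositionalEquality

open +-*-Solver

ΣFin-cong : ∀ n {f g : Fin n → ℚ} → (∀ i → f i ≡ g i) → ΣFin n f ≡ ΣFin n g
ΣFin-cong zero    f≗g = refl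
ΣFin-cong (suc n) f≗g = cong₂ _+_ (f≗g zero) (ΣFin-cong n (f≗g ∘ suc))

ΣFin-zero : ∀ n {f : Fin n → ℚ} → (∀ i → f i ≡ 0ℚ) → ΣFin n f ≡ 0ℚ
ΣFin-zero zero    f≗0 = refl
ΣFin-zero (suc n) f≗0 rewrite f≗0 zero | ΣFin-zero n (f≗0 ∘ suc) = refl

ΣFin-distrib-- : ∀ n (f g : Fin n → ℚ) → ΣFin n (λ i → f i - g i) ≡ ΣFin n f - ΣFin n g
ΣFin-distrib-- zero    f g = refl
ΣFin-distrib-- (suc n) f g rewrite ΣFin-distrib-- n (f ∘ suc) (g ∘ suc) =
  solve 4 (λ a b c d → (a :- b) :+ (c :- d) := (a :+ c) :- (b :+ d)) refl
    (f zero) (g zero) (ΣFin n (f ∘ suc)) (ΣFin n (g ∘ suc))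

*-distribʳ-ΣFin : ∀ n (f : Fin n → ℚ) c → ΣFin n f * c ≡ ΣFin n (λ i → f i * c)
*-distribʳ-ΣFin zero    f c = *-zeroˡ c
*-distribʳ-ΣFin (suc n) f c rewrite sym (*-distribʳ-ΣFin n (f ∘ suc) c) =
  *-distribʳ-+ c (f zero) (ΣFin n (f ∘ suc))

ΣFin-single : ∀ n (f : Fin n → ℚ) j → (∀ i → i ≢ j → f i ≡ 0ℚ) → ΣFin n f ≡ f j
ΣFin-single (suc n) f zero off rewrite ΣFin-zero n (λ i → off (suc i) λ ()) = +-identityʳ (f zero)
ΣFin-single (suc n) f (suc j) off
  rewrite off zero (λ ()) | ΣFin-single n (f ∘ suc) j (λ i i≢j → off (suc i) (i≢j ∘ Finₚ.suc-injective))
  = +-identityˡ (f (suc j))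

+suc/1 : ∀ l → + suc l / 1 ≡ 1ℚ + + l / 1
+suc/1 l rewrite normalize-coprime (coprime-sym (1-coprimeTo l)) | ℕₚ.*-identityʳ l | ℤₚ.+◃n≡+n l = refl

ΣFin-const : ∀ n c → ΣFin n (λ _ → c) ≡ (+ n / 1) * c
ΣFin-const zero    c = sym (*-zeroˡ c)
ΣFin-const (suc n) c rewrite ΣFin-const n c | +suc/1 n =
  solve 2 (λ c m → c :+ m :* c := (con 1ℚ :+ m) :* c) refl c (+ n / 1)

ΣFin-↑ : ∀ m k (f : Fin (m ℕ.+ k) → ℚ) → ΣFin (m ℕ.+ k) f ≡ ΣFin m (λ i → f (i ↑ˡ k)) + ΣFin k (λ i → f (m ↑ʳ i))
ΣFin-↑ zero    k f = sym (+-identityˡ _)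
ΣFin-↑ (suc m) k f rewrite ΣFin-↑ m k (f ∘ suc) =
  sym (+-assoc (f zero) (ΣFin m (λ i → f (suc (i ↑ˡ k)))) (ΣFin k (λ i → f (suc (m ↑ʳ i)))))

ΣFin-combine : ∀ l n (f : Fin (l ℕ.* n) → ℚ) → ΣFin (l ℕ.* n) f ≡ ΣFin l (λ i → ΣFin n (λ u → f (combine i u)))
ΣFin-combine zero    n f = refl
ΣFin-combine (suc l) n f rewrite ΣFin-↑ n (l ℕ.* n) f | ΣFin-combine l n (λ x → f (n ↑ʳ x)) = refl

⌊⌋-true⇒ : ∀ {A : Set} (a? : Dec A) → ⌊ a? ⌋ ≡ true → A
⌊⌋-true⇒ (yes a) _ = a

⌊⌋-true : ∀ {A : Set} (a? : Dec A) → A → ⌊ a? ⌋ ≡ true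
⌊⌋-true a? a = trans (isYes≗does a?) (dec-true a? a)

⌊⌋-false : ∀ {A : Set} (a? : Dec A) → ¬ A → ⌊ a? ⌋ ≡ false
⌊⌋-false a? ¬a = trans (isYes≗does a?) (dec-false a? ¬a)

anyFin-true⇒∃ : ∀ n (f : Fin n → Bool) → anyFin n f ≡ true → ∃ λ i → f i ≡ true
anyFin-true⇒∃ (suc n) f any with f zero in f₀
... | true  = zero , f₀
... | false with i , fᵢ ← anyFin-true⇒∃ n (f ∘ suc) any = suc i , fᵢ

∃⇒anyFin-true : ∀ n (f : Fin n → Bool) i → f i ≡ true → anyFin n f ≡ true
∃⇒anyFin-true (suc n) f zero    fᵢ rewrite fᵢ = refl
∃⇒anyFin-true (suc n) f (suc i) fᵢ rewrite ∃⇒anyFin-true n (f ∘ suc) i fᵢ = ∨-zeroʳ (f zero)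

ΣFin-indicator : ∀ n (a : Fin n → Bool) w y → a w ≡ true → (∀ v → a v ≡ true → v ≡ w) →
                 ΣFin n (λ v → boolℚ (a v) * y) ≡ y
ΣFin-indicator n a w y aw unique =
  trans (ΣFin-single n (λ v → boolℚ (a v) * y) w off)
        (trans (cong (λ b → boolℚ b * y) aw) (*-identityˡ y))
  where
  off : ∀ v → v ≢ w → boolℚ (a v) * y ≡ 0ℚ
  off v v≢w rewrite ¬-not {a v} {true} (v≢w ∘ unique v) = *-zeroˡ y

δ : ∀ {k} → Fin k → Fin k → ℚ
δ s t = boolℚ ⌊ s ≟ t ⌋

ΣFin-*δ : ∀ k (d : Fin k → ℚ) s → ΣFin k (λ t → d t * δ t s) ≡ d s
ΣFin-*δ k d s = trans (ΣFin-single k (λ t → d t * δ t s) s off) diagonal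
  where
  off : ∀ t → t ≢ s → d t * δ t s ≡ 0ℚ
  off t t≢s rewrite ⌊⌋-false (t ≟ s) t≢s = *-zeroʳ (d t)
  diagonal : d s * δ s s ≡ d s
  diagonal rewrite ⌊⌋-true (s ≟ s) refl = *-identityʳ (d s)

ΣFin-δ : ∀ k (t : Fin k) → ΣFin k (δ t) ≡ 1ℚ
ΣFin-δ k t = trans (ΣFin-single k (δ t) t off) diagonal
  where
  off : ∀ s → s ≢ t → δ t s ≡ 0ℚ
  off s s≢t rewrite ⌊⌋-false (t ≟ s) (s≢t ∘ sym) = refl
  diagonal : δ t t ≡ 1ℚ
  diagonal rewrite ⌊⌋-true (t ≟ t) refl = refl

zeroSumBasis : ∀ {k} → Fin k → Fin (suc k) → ℚ
zeroSumBasis t zero    = - 1ℚ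
zeroSumBasis t (suc s) = δ t s

ΣFin-zeroSumBasis : ∀ k (t : Fin k) → ΣFin (suc k) (zeroSumBasis t) ≡ 0ℚ
ΣFin-zeroSumBasis k t = trans (cong (_+_ (- 1ℚ)) (ΣFin-δ k t)) (+-inverseˡ 1ℚ)

zeroSumBasis-linearlyIndependent : ∀ {k} → LinearlyIndependent (zeroSumBasis {k})
zeroSumBasis-linearlyIndependent {k} d combination≡0 s =
  trans (sym (ΣFin-*δ k d s)) (combination≡0 (suc s))

blockConstant : ∀ {l} n → (Fin l → ℚ) → Fin (l ℕ.* n) → ℚ
blockConstant n c = c ∘ quotient n

blockConstant-combine : ∀ {l} n (c : Fin l → ℚ) i u → blockConstant n c (combine i u) ≡ c i
blockConstant-combine n c i u = cong (c ∘ proj₁) (Finₚ.remQuot-combine i u)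

blockConstant-linearlyIndependent : ∀ {k l m} {cs : Fin k → Fin l → ℚ} →
  LinearlyIndependent cs → LinearlyIndependent (λ t → blockConstant (suc m) (cs t))
blockConstant-linearlyIndependent {k} {m = m} {cs} independent d combination≡0 =
  independent d λ i → trans
    (ΣFin-cong k (λ t → cong (d t *_) (sym (blockConstant-combine (suc m) (cs t) i zero))))
    (combination≡0 (combine i zero))

laplacianApply-differences : ∀ {N} (a : Fin N → Fin N → Bool) x v →
  laplacianApply a x v ≡ ΣFin N (λ w → boolℚ (a v w) * (x v - x w))
laplacianApply-differences {N} a x v = begin
  ΣFin N (λ w → boolℚ (a v w)) * x v - ΣFin N (λ w → boolℚ (a v w) * x w)
    ≡⟨ cong (_- ΣFin N (λ w → boolℚ (a v w) * x w)) (*-distribʳ-ΣFin N (λ w → boolℚ (a v w)) (x v)) ⟩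
  ΣFin N (λ w → boolℚ (a v w) * x v) - ΣFin N (λ w → boolℚ (a v w) * x w)
    ≡⟨ sym (ΣFin-distrib-- N (λ w → boolℚ (a v w) * x v) (λ w → boolℚ (a v w) * x w)) ⟩
  ΣFin N (λ w → boolℚ (a v w) * x v - boolℚ (a v w) * x w)
    ≡⟨ ΣFin-cong N (λ w → solve 3 (λ a y z → a :* y :- a :* z := a :* (y :- z)) refl
                                 (boolℚ (a v w)) (x v) (x w)) ⟩
  ΣFin N (λ w → boolℚ (a v w) * (x v - x w)) ∎
  where open ≡-Reasoning

pow-+ : ∀ {n} (φ : Permutation′ n) i j v → pow φ (i ℕ.+ j) v ≡ pow φ i (pow φ j v)
pow-+ φ zero    j v = refl
pow-+ φ (suc i) j v = cong (φ ⟨$⟩ʳ_) (pow-+ φ i j v)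

Fin-injective⇒surjective : ∀ {n} {f : Fin n → Fin n} → Injective _≡_ _≡_ f → ∀ u → ∃ λ j → f j ≡ u
Fin-injective⇒surjective {suc m} {f} injective u with Finₚ.any? (λ j → f j ≟ u)
... | yes hit = hit
... | no  miss = ⊥-elim (Finₚ.<⇒notInjective (ℕₚ.n<1+n m) avoiding-injective)
  where
  misses : ∀ j → u ≢ f j
  misses j u≡fj = miss (j , sym u≡fj)
  avoiding : Fin (suc m) → Fin m
  avoiding j = punchOut (misses j)
  avoiding-injective : Injective _≡_ _≡_ avoiding
  avoiding-injective {i} {j} = injective ∘ Finₚ.punchOut-injective (misses i) (misses j)

covers⇒nonempty : ∀ {n k} {φ : Permutation′ n} {B : Subset n} → Covers k φ B → Fin n → ∃ λ b → B b ≡ true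
covers⇒nonempty cover v with _ , _ , b , b∈B , _ ← cover v = b , b∈B

pow⇒inLayer : ∀ {n} (φ : Permutation′ n) (B : Subset n) {b} j u → B b ≡ true → pow φ j b ≡ u → inLayer φ B j u ≡ true
pow⇒inLayer {n} φ B {b} j u b∈B refl =
  ∃⇒anyFin-true n (λ b' → B b' ∧ ⌊ pow φ j b' ≟ u ⌋) b (cong₂ _∧_ b∈B (⌊⌋-true (u ≟ u) refl))

FixedPointFreePowers : ∀ {n} → ℕ → Permutation′ n → Set
FixedPointFreePowers k φ = ∀ j → 0 ℕ.< j → j ℕ.< k → ∀ v → ¬ pow φ j v ≡ v

module FreeCyclicAction {n} (φ : Permutation′ n) (free : FixedPointFreePowers n φ) where

  orbit : Fin n → Fin n → Fin n
  orbit b j = pow φ (toℕ j) b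

  private
    orbit-<-distinct : ∀ b {i j} → toℕ i ℕ.< toℕ j → orbit b i ≢ orbit b j
    orbit-<-distinct b {i} {j} i<j φⁱb≡φʲb = free (toℕ j ∸ toℕ i) (ℕₚ.m<n⇒0<n∸m i<j)
      (ℕₚ.≤-<-trans (ℕₚ.m∸n≤m (toℕ j) (toℕ i)) (Finₚ.toℕ<n j)) (orbit b i)
      (begin
        pow φ (toℕ j ∸ toℕ i) (pow φ (toℕ i) b) ≡⟨ sym (pow-+ φ (toℕ j ∸ toℕ i) (toℕ i) b) ⟩
        pow φ (toℕ j ∸ toℕ i ℕ.+ toℕ i) b       ≡⟨ cong (λ e → pow φ e b) (ℕₚ.m∸n+n≡m (ℕₚ.<⇒≤ i<j)) ⟩
        orbit b j                              ≡⟨ sym φⁱb≡φʲb ⟩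
        orbit b i                              ∎)
      where open ≡-Reasoning

  orbit-injective : ∀ b → Injective _≡_ _≡_ (orbit b)
  orbit-injective b {i} {j} φⁱb≡φʲb with ℕₚ.<-cmp (toℕ i) (toℕ j)
  ... | tri< i<j _ _ = ⊥-elim (orbit-<-distinct b i<j φⁱb≡φʲb)
  ... | tri≈ _ i≡j _ = Finₚ.toℕ-injective i≡j
  ... | tri> _ _ j<i = ⊥-elim (orbit-<-distinct b j<i (sym φⁱb≡φʲb))

  orbit-surjective : ∀ b u → ∃ λ j → orbit b j ≡ u
  orbit-surjective b = Fin-injective⇒surjective (orbit-injective b)

  -- Any b ∈ B already covers V on its own, so minimality of B forces B ⊆ {b}.
  base-singleton : ∀ {B} → IsBase n φ B → ∀ {b b'} → B b ≡ true → B b' ≡ true → b' ≡ b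
  base-singleton {B} (_ , minimal) {b} {b'} b∈B b'∈B =
    ⌊⌋-true⇒ (b' ≟ b) (minimal singleton ⊆B covers b' b'∈B)
    where
    singleton : Subset n
    singleton v = ⌊ v ≟ b ⌋
    ⊆B : singleton ⊆ B
    ⊆B v v≡b rewrite ⌊⌋-true⇒ (v ≟ b) v≡b = b∈B
    covers : Covers n φ singleton
    covers v with j , φʲb≡v ← orbit-surjective b v =
      toℕ j , Finₚ.toℕ<n j , b , ⌊⌋-true (b ≟ b) refl , φʲb≡v

  inLayer⇒pow : ∀ {B} → IsBase n φ B → ∀ {b} j u → B b ≡ true → inLayer φ B j u ≡ true → pow φ j b ≡ u
  inLayer⇒pow {B} base {b} j u b∈B inLayer
    with b' , b'∈layer ← anyFin-true⇒∃ n (λ b' → B b' ∧ ⌊ pow φ j b' ≟ u ⌋) inLayer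
    with refl ← base-singleton base b∈B (∧-conicalˡ (B b') _ b'∈layer)
    = ⌊⌋-true⇒ (pow φ j b ≟ u) (∧-conicalʳ (B b) _ b'∈layer)

layerAdj : (k : ℕ) {n : ℕ} → Permutation′ n → Subset n → Permutation′ n → Subset n → Fin n → Fin n → Bool
layerAdj k φ B φ' B' u u' = anyFin k (λ j → inLayer φ B (toℕ j) u ∧ inLayer φ' B' (toℕ j) u')

joinAdj-combine : ∀ k l n G φ B (i i' : Fin l) (u u' : Fin n) →
  joinAdj k l n G φ B (combine i u) (combine i' u')
    ≡ (if ⌊ i ≟ i' ⌋ then adj (G i) u u' else layerAdj k (φ i) (B i) (φ i') (B i') u u')
joinAdj-combine k l n G φ B i i' u u'
  -- remQuot unfolds to swap ∘ quotRem, and that is the form joinAdj's with-clauses abstract over.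
  rewrite cong swap (Finₚ.remQuot-combine {l} {n} i u)
        | cong swap (Finₚ.remQuot-combine {l} {n} i' u') = refl

module Join {m l : ℕ} (G : Fin l → Graph (suc m)) (φ : Fin l → Permutation′ (suc m))
  (B : Fin l → Subset (suc m))
  (free : ∀ i → FixedPointFreePowers (suc m) (φ i))
  (based : ∀ i → IsBase (suc m) (φ i) (B i)) where

  private
    n : ℕ
    n = suc m

    A : Fin (l ℕ.* n) → Fin (l ℕ.* n) → Bool
    A = joinAdj n l n G φ B

    module Action (i : Fin l) = FreeCyclicAction (φ i) (free i)

    root : Fin l → Fin n
    root i = proj₁ (covers⇒nonempty (proj₁ (based i)) zero)

    root∈B : ∀ i → B i (root i) ≡ true
    root∈B i = proj₂ (covers⇒nonempty (proj₁ (based i)) zero)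

    layer : Fin l → Fin n → Fin n
    layer i u = proj₁ (Action.orbit-surjective i (root i) u)

    orbit-layer : ∀ i u → Action.orbit i (root i) (layer i u) ≡ u
    orbit-layer i u = proj₂ (Action.orbit-surjective i (root i) u)

    partner : Fin l → Fin l → Fin n → Fin n
    partner i i' u = Action.orbit i' (root i') (layer i u)

  layerAdj-partner : ∀ i i' u → layerAdj n (φ i) (B i) (φ i') (B i') u (partner i i' u) ≡ true
  layerAdj-partner i i' u =
    ∃⇒anyFin-true n (λ j → inLayer (φ i) (B i) (toℕ j) u ∧ inLayer (φ i') (B i') (toℕ j) (partner i i' u))
      (layer i u)
      (cong₂ _∧_ (pow⇒inLayer (φ i) (B i) (toℕ (layer i u)) u (root∈B i) (orbit-layer i u))
                 (pow⇒inLayer (φ i') (B i') (toℕ (layer i u)) (partner i i' u) (root∈B i') refl))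

  layerAdj⇒partner : ∀ i i' u u' → layerAdj n (φ i) (B i) (φ i') (B i') u u' ≡ true → u' ≡ partner i i' u
  layerAdj⇒partner i i' u u' adjacent
    with j , inLayers ← anyFin-true⇒∃ n (λ j → inLayer (φ i) (B i) (toℕ j) u ∧ inLayer (φ i') (B i') (toℕ j) u') adjacent
    with refl ← Action.orbit-injective i (root i) {j} {layer i u}
                  (trans (Action.inLayer⇒pow i (based i) (toℕ j) u (root∈B i) (∧-conicalˡ _ _ inLayers))
                         (sym (orbit-layer i u)))
    = sym (Action.inLayer⇒pow i' (based i') (toℕ j) u' (root∈B i') (∧-conicalʳ _ _ inLayers))

  -- Inside block i the weights c i − c i vanish; towards another block there is exactly one edge.
  ΣFin-block : ∀ (c : Fin l → ℚ) i u i' →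
    ΣFin n (λ u' → boolℚ (A (combine i u) (combine i' u')) * (c i - c i')) ≡ c i - c i'
  ΣFin-block c i u i' with i ≟ i'
  ... | yes refl = trans (ΣFin-zero n no-weight) (sym (+-inverseʳ (c i)))
    where
    no-weight : ∀ u' → boolℚ (A (combine i u) (combine i u')) * (c i - c i) ≡ 0ℚ
    no-weight u' rewrite +-inverseʳ (c i) = *-zeroʳ (boolℚ (A (combine i u) (combine i u')))
  ... | no i≢i' = trans (ΣFin-cong n λ u' → cong (λ a → boolℚ a * (c i - c i')) (cross u'))
                        (ΣFin-indicator n (layerAdj n (φ i) (B i) (φ i') (B i') u) (partner i i' u) (c i - c i')
                           (layerAdj-partner i i' u) (layerAdj⇒partner i i' u))
    where
    cross : ∀ u' → A (combine i u) (combine i' u') ≡ layerAdj n (φ i) (B i) (φ i') (B i') u u'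
    cross u' rewrite joinAdj-combine n l n G φ B i i' u u' | ⌊⌋-false (i ≟ i') i≢i' = refl

  laplacianApply-blockConstant : ∀ c i u →
    laplacianApply A (blockConstant n c) (combine i u) ≡ ΣFin l (λ i' → c i - c i')
  laplacianApply-blockConstant c i u = begin
    laplacianApply A x v
      ≡⟨ laplacianApply-differences A x v ⟩
    ΣFin (l ℕ.* n) (λ w → boolℚ (A v w) * (x v - x w))
      ≡⟨ ΣFin-combine l n _ ⟩
    ΣFin l (λ i' → ΣFin n (λ u' → boolℚ (A v (combine i' u')) * (x v - x (combine i' u'))))
      ≡⟨ ΣFin-cong l (λ i' → ΣFin-cong n (λ u' → cong₂ (λ p q → boolℚ (A v (combine i' u')) * (p - q))
                                              (blockConstant-combine n c i u) (blockConstant-combine n c i' u'))) ⟩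
    ΣFin l (λ i' → ΣFin n (λ u' → boolℚ (A v (combine i' u')) * (c i - c i')))
      ≡⟨ ΣFin-cong l (ΣFin-block c i u) ⟩
    ΣFin l (λ i' → c i - c i') ∎
    where
    open ≡-Reasoning
    x : Fin (l ℕ.* n) → ℚ
    x = blockConstant n c
    v : Fin (l ℕ.* n)
    v = combine i u

  blockConstant-eigenvector : ∀ c → ΣFin l c ≡ 0ℚ → InEigenspace A (+ l / 1) (blockConstant n c)
  blockConstant-eigenvector c Σc≡0 v with i , u , refl ← Finₚ.combine-surjective {l} {n} v = begin
    laplacianApply A (blockConstant n c) (combine i u) ≡⟨ laplacianApply-blockConstant c i u ⟩
    ΣFin l (λ i' → c i - c i')                         ≡⟨ ΣFin-distrib-- l (λ _ → c i) c ⟩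
    ΣFin l (λ _ → c i) - ΣFin l c                      ≡⟨ cong₂ _-_ (ΣFin-const l (c i)) Σc≡0 ⟩
    (+ l / 1) * c i - 0ℚ                               ≡⟨ +-identityʳ ((+ l / 1) * c i) ⟩
    (+ l / 1) * c i                                    ≡⟨ cong ((+ l / 1) *_) (sym (blockConstant-combine n c i u)) ⟩
    (+ l / 1) * blockConstant n c (combine i u)        ∎
    where open ≡-Reasoning

corollary4p3 : (n l : ℕ) → .{{_ : NonZero n}}
    → (G : Fin l → Graph n) → (φ : Fin l → Permutation′ n) → (B : Fin l → Subset n)
    → (∀ i → IsKSymmetricAut n (G i) (φ i))
    → (∀ i → IsBase n (φ i) (B i))
    → MultiplicityAtLeast (joinAdj n l n G φ B) (+ l / 1) (l ∸ 1)
corollary4p3 zero    l {{nonZero}} = Irrelevant.⊥-elim (NonZero.nonZero nonZero)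
corollary4p3 (suc m) zero    G φ B symmetric based = (λ ()) , (λ _ _ ()) , (λ ())
corollary4p3 (suc m) (suc k) G φ B symmetric based =
  (λ t → blockConstant (suc m) (zeroSumBasis t)) ,
  blockConstant-linearlyIndependent zeroSumBasis-linearlyIndependent ,
  λ t → blockConstant-eigenvector (zeroSumBasis t) (ΣFin-zeroSumBasis k t)
  where open Join G φ B (proj₂ ∘ proj₂ ∘ symmetric) based
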